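{- Let $S[1\ldots n]$ be a string with suffix array $SA$, rank array $Rank$ and lcp array $LCP[1\ldots n+1]$. For $i=1,\ldots,n$ let $L_i=\max\{LCP[Rank[i]],\,LCP[Rank[i]+1]\}$. Then if $L_i>0$, the left-bounded longest repeat starting at position $i$ is $S[i\ldots i+L_i-1]$, and if $L_i=0$, the left-bounded longest repeat starting at position $i$ does not exist.
   Context: For a string $S[1\ldots n]$ over $\Sigma=\{1,\ldots,\sigma\}$, $S[i\ldots j]=S[i]\cdots S[j]$. Strings are compared lexicographically, with a proper prefix smaller than the longer string. A substring $S[i\ldots j]$ is unique if there is no other substring $S[i'\ldots j']$ equal to it with $i'\neq i$; a repeat is a non-unique substring. The left-bounded longest repeat starting at position $k$ is the repeat $S[k\ldots j]$ such that either $j=n$ or $S[k\ldots j+1]$ is unique (it exists iff $S[k]$ occurs at least twice in $S$). The suffix array $SA[1\ldots n]$ is the permutation of $\{1,\ldots,n\}$ with $S[SA[i]\ldots n]<S[SA[j]\ldots n]$ for $i<j$; the rank array is its inverse ($Rank[i]=j$ iff $SA[j]=i$). The lcp array $LCP[1\ldots n+1]$ has $LCP[1]=LCP[n+1]=0$ and, for $2\le i\le n$, $LCP[i]$ is the length of the longest common prefix of $S[SA[i-1]\ldots n]$ and $S[SA[i]\ldots n]$. -}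

module Defs where

open import Data.Nat using (ℕ; zero; suc; _+_; _<_; _≤_; _⊔_)
open import Data.Nat.Properties using (_<?_)
open import Data.Fin using (Fin; toℕ; fromℕ<)
import Data.Fin as F
open import Data.Fin.Properties using () renaming (_≟_ to _≟F_)
open import Data.List using (List; []; _∷_; drop; take)
open import Data.Vec.Functional using (Vector; toList)
open import Data.List.Relation.Binary.Lex.Strict using (Lex-<)
open import Data.Product using (Σ; _×_; ∃)
open import Data.Sum using (_⊎_)
open import Relation.Binary.PropositionalEquality using (_≡_)
open import Relation.Nullary using (¬_; yes; no)

-- Conventions: positions and ranks are 0-based (Fin n / ℕ);
-- a string of length n over Σ = {1..σ} is  S : Vector (Fin σ) n.
-- Substrings are given by a start position i and a length ℓ,
-- so S[i…j] (1-based) corresponds to (i-1 , j-i+1).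

module _ {σ n : ℕ} (S : Vector (Fin σ) n) where

  suf : Fin n → List (Fin σ)
  suf i = drop (toℕ i) (toList S)

  sub : ℕ → ℕ → List (Fin σ)
  sub i ℓ = take ℓ (drop i (toList S))

  -- lexicographic strict order; a proper prefix is smaller
  _<lex_ : List (Fin σ) → List (Fin σ) → Set
  _<lex_ = Lex-< _≡_ F._<_

  IsSuffixArray : (Fin n → Fin n) → Set
  IsSuffixArray SA = ∀ (a b : Fin n) → a F.< b → suf (SA a) <lex suf (SA b)

  IsRankArray : (Fin n → Fin n) → (Fin n → Fin n) → Set
  IsRankArray SA Rank = (∀ i → SA (Rank i) ≡ i) × (∀ j → Rank (SA j) ≡ j)

  IsRepeat : ℕ → ℕ → Set
  IsRepeat i ℓ = 1 ≤ ℓ × i + ℓ ≤ n ×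
    ∃ λ i' → ¬ (i' ≡ i) × i' + ℓ ≤ n × sub i' ℓ ≡ sub i ℓ

  IsUnique : ℕ → ℕ → Set
  IsUnique i ℓ = 1 ≤ ℓ × i + ℓ ≤ n × ¬ IsRepeat i ℓ

  IsLBLR : ℕ → ℕ → Set
  IsLBLR k ℓ = IsRepeat k ℓ × (k + ℓ ≡ n ⊎ IsUnique k (suc ℓ))

lcp : ∀ {σ} → List (Fin σ) → List (Fin σ) → ℕ
lcp [] _ = 0
lcp (_ ∷ _) [] = 0
lcp (x ∷ xs) (y ∷ ys) with x ≟F y
... | yes _ = suc (lcp xs ys)
... | no _ = 0

-- The lcp array LCP[1 … n+1], indexed 1-based exactly as in the paper:
-- LCP[1] = LCP[n+1] = 0 and, for 2 ≤ k ≤ n, LCP[k] is the lcp of the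
-- suffixes of (1-based) ranks k-1 and k, i.e. 0-based ranks k-2 and k-1.
-- (Out-of-range indices also give 0; they are never used.)
LCP : ∀ {σ n} → Vector (Fin σ) n → (Fin n → Fin n) → ℕ → ℕ
LCP S SA zero = 0
LCP S SA (suc zero) = 0
LCP {n = n} S SA (suc (suc m)) with m <? n | suc m <? n
... | yes p | yes q = lcp (suf S (SA (fromℕ< p))) (suf S (SA (fromℕ< q)))
... | _ | _ = 0

-- L_i = max(LCP[Rank[i]], LCP[Rank[i]+1]) with Rank 1-based,
-- i.e. 1-based rank = toℕ (Rank i) + 1
Lval : ∀ {σ n} → Vector (Fin σ) n → (Fin n → Fin n) → (Fin n → Fin n) → Fin n → ℕ
Lval S SA Rank i = LCP S SA (suc (toℕ (Rank i))) ⊔ LCP S SA (suc (suc (toℕ (Rank i))))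

-- For suffix-array ranks a < b < c, the lcp of the suffixes of ranks a and c is at most both
-- the lcp of ranks a, b and that of ranks b, c.  Hence the longest common prefix of suf i with
-- any other suffix is attained at a rank-neighbour of suf i, and equals L_i.  A prefix of suf i
-- of length ℓ ≥ 1 is a repeat iff some other suffix shares it, so the repeats starting at i have
-- exactly the lengths 1 … L_i: the longest of them is the left-bounded longest repeat, and there
-- is none when L_i = 0.
module Submission where

open import Defs
open import Data.Nat using (ℕ; zero; suc; _<_; _≤_; _∸_; _+_; _⊔_; z≤n; s≤s; s≤s⁻¹)
open import Data.Nat.Properties
open import Data.Fin using (Fin; toℕ; fromℕ<)
import Data.Fin as F
open import Data.Fin.Properties using (toℕ-injective; toℕ<n; toℕ-fromℕ<) renaming (_≟_ to _≟F_)
import Data.Fin.Properties as Fₚ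
open import Data.List using (List; []; _∷_; take; length)
open import Data.List.Properties using (length-drop; length-tabulate; ∷-injectiveˡ; ∷-injectiveʳ)
open import Data.List.Relation.Binary.Lex.Strict using (Lex-<)
open import Data.List.Relation.Binary.Lex.Core using (base; halt; this; next)
open import Data.Vec.Functional using (Vector; toList)
open import Data.Product using (_×_; _,_; ∃; proj₁; proj₂)
import Data.Product as Product
open import Data.Sum using (_⊎_; inj₁; inj₂; [_,_])
open import Data.Empty using (⊥-elim)
open import Function using (_∘_; _⇔_; mk⇔; Equivalence)
open import Relation.Binary.PropositionalEquality
  using (_≡_; _≢_; refl; sym; trans; cong; cong₂; subst; subst₂)
open import Relation.Binary.Definitions using (tri<; tri≈; tri>)
open import Relation.Nullary using (¬_; yes; no)

open Equivalence using (to; from)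

module _ {σ : ℕ} where

  lcp-∷-≡ : (a : Fin σ) (xs ys : List (Fin σ)) → lcp (a ∷ xs) (a ∷ ys) ≡ suc (lcp xs ys)
  lcp-∷-≡ a xs ys with a ≟F a
  ... | yes _ = refl
  ... | no a≢a = ⊥-elim (a≢a refl)

  lcp-∷-≢ : {a c : Fin σ} (xs ys : List (Fin σ)) → a ≢ c → lcp (a ∷ xs) (c ∷ ys) ≡ 0
  lcp-∷-≢ {a} {c} xs ys a≢c with a ≟F c
  ... | yes a≡c = ⊥-elim (a≢c a≡c)
  ... | no _ = refl

  lcp-comm : (xs ys : List (Fin σ)) → lcp xs ys ≡ lcp ys xs
  lcp-comm [] [] = refl
  lcp-comm [] (_ ∷ _) = refl
  lcp-comm (_ ∷ _) [] = refl
  lcp-comm (x ∷ xs) (y ∷ ys) with x ≟F y | y ≟F x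
  ... | yes _ | yes _ = cong suc (lcp-comm xs ys)
  ... | yes x≡y | no y≢x = ⊥-elim (y≢x (sym x≡y))
  ... | no x≢y | yes y≡x = ⊥-elim (x≢y (sym y≡x))
  ... | no _ | no _ = refl

  lcp≤lengthˡ : (xs ys : List (Fin σ)) → lcp xs ys ≤ length xs
  lcp≤lengthˡ [] _ = z≤n
  lcp≤lengthˡ (_ ∷ _) [] = z≤n
  lcp≤lengthˡ (x ∷ xs) (y ∷ ys) with x ≟F y
  ... | yes _ = s≤s (lcp≤lengthˡ xs ys)
  ... | no _ = z≤n

  lcp≤lengthʳ : (xs ys : List (Fin σ)) → lcp xs ys ≤ length ys
  lcp≤lengthʳ xs ys = subst (_≤ length ys) (lcp-comm ys xs) (lcp≤lengthˡ ys xs)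

  ≤lcp⇒take≡ : (ℓ : ℕ) (xs ys : List (Fin σ)) → ℓ ≤ lcp xs ys → take ℓ xs ≡ take ℓ ys
  ≤lcp⇒take≡ zero xs ys _ = refl
  ≤lcp⇒take≡ (suc ℓ) (x ∷ xs) (y ∷ ys) _ with x ≟F y
  ≤lcp⇒take≡ (suc ℓ) (x ∷ xs) (.x ∷ ys) (s≤s ℓ≤lcp) | yes refl =
    cong (x ∷_) (≤lcp⇒take≡ ℓ xs ys ℓ≤lcp)

  take≡⇒≤lcp : (ℓ : ℕ) (xs ys : List (Fin σ)) →
    ℓ ≤ length xs → take ℓ xs ≡ take ℓ ys → ℓ ≤ lcp xs ys
  take≡⇒≤lcp zero xs ys _ _ = z≤n
  take≡⇒≤lcp (suc ℓ) (x ∷ xs) [] _ ()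
  take≡⇒≤lcp (suc ℓ) (x ∷ xs) (y ∷ ys) (s≤s ℓ≤len) eq with x ≟F y
  ... | yes _ = s≤s (take≡⇒≤lcp ℓ xs ys ℓ≤len (∷-injectiveʳ eq))
  ... | no x≢y = ⊥-elim (x≢y (∷-injectiveˡ eq))

  lcp-between : {xs ys zs : List (Fin σ)} →
    Lex-< _≡_ F._<_ xs ys → Lex-< _≡_ F._<_ ys zs →
    lcp xs zs ≤ lcp xs ys × lcp xs zs ≤ lcp ys zs
  lcp-between (base ()) _
  lcp-between halt _ = z≤n , z≤n
  lcp-between {_ ∷ xs} {_} {_ ∷ zs} (this a<b) (this b<c)
    rewrite lcp-∷-≢ xs zs (Fₚ.<⇒≢ (Fₚ.<-trans a<b b<c)) = z≤n , z≤n
  lcp-between {_ ∷ xs} {_} {_ ∷ zs} (this a<b) (next refl _)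
    rewrite lcp-∷-≢ xs zs (Fₚ.<⇒≢ a<b) = z≤n , z≤n
  lcp-between {_ ∷ xs} {_} {_ ∷ zs} (next refl _) (this b<c)
    rewrite lcp-∷-≢ xs zs (Fₚ.<⇒≢ b<c) = z≤n , z≤n
  lcp-between {a ∷ xs} {_ ∷ ys} {_ ∷ zs} (next refl xs<ys) (next refl ys<zs)
    rewrite lcp-∷-≡ a xs zs | lcp-∷-≡ a xs ys | lcp-∷-≡ a ys zs =
    Product.map s≤s s≤s (lcp-between xs<ys ys<zs)

module _ {σ n : ℕ} (S : Vector (Fin σ) n) where

  length-suf : (i : Fin n) → length (suf S i) ≡ n ∸ toℕ i
  length-suf i = trans (length-drop (toℕ i) (toList S)) (cong (_∸ toℕ i) (length-tabulate S))

  +≤n⇒≤length-suf : (i : Fin n) (ℓ : ℕ) → toℕ i + ℓ ≤ n → ℓ ≤ length (suf S i)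
  +≤n⇒≤length-suf i ℓ i+ℓ≤n =
    subst (ℓ ≤_) (sym (length-suf i)) (m+n≤o⇒m≤o∸n ℓ (subst (_≤ n) (+-comm (toℕ i) ℓ) i+ℓ≤n))

  ≤length-suf⇒+≤n : (i : Fin n) (ℓ : ℕ) → ℓ ≤ length (suf S i) → toℕ i + ℓ ≤ n
  ≤length-suf⇒+≤n i ℓ ℓ≤len = subst (_≤ n) (+-comm ℓ (toℕ i))
    (m≤o∸n⇒m+n≤o ℓ (<⇒≤ (toℕ<n i)) (subst (ℓ ≤_) (length-suf i) ℓ≤len))

  repeat⇒≤lcp : (i : Fin n) (ℓ : ℕ) → IsRepeat S (toℕ i) ℓ →
    ∃ λ j → j ≢ i × ℓ ≤ lcp (suf S i) (suf S j)
  repeat⇒≤lcp i ℓ (1≤ℓ , i+ℓ≤n , i′ , i′≢i , i′+ℓ≤n , same) = j , j≢i , ℓ≤lcp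
    where
    i′<n : i′ < n
    i′<n = <-≤-trans (m<m+n i′ 1≤ℓ) i′+ℓ≤n
    j : Fin n
    j = fromℕ< i′<n
    j≢i : j ≢ i
    j≢i j≡i = i′≢i (trans (sym (toℕ-fromℕ< i′<n)) (cong toℕ j≡i))
    ℓ≤lcp : ℓ ≤ lcp (suf S i) (suf S j)
    ℓ≤lcp = take≡⇒≤lcp ℓ (suf S i) (suf S j) (+≤n⇒≤length-suf i ℓ i+ℓ≤n)
      (trans (sym same) (cong (λ p → sub S p ℓ) (sym (toℕ-fromℕ< i′<n))))

  ≤lcp⇒repeat : (i j : Fin n) (ℓ : ℕ) → j ≢ i → 1 ≤ ℓ →
    ℓ ≤ lcp (suf S i) (suf S j) → IsRepeat S (toℕ i) ℓ
  ≤lcp⇒repeat i j ℓ j≢i 1≤ℓ ℓ≤lcp =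
    1≤ℓ ,
    ≤length-suf⇒+≤n i ℓ (≤-trans ℓ≤lcp (lcp≤lengthˡ (suf S i) (suf S j))) ,
    toℕ j , j≢i ∘ toℕ-injective ,
    ≤length-suf⇒+≤n j ℓ (≤-trans ℓ≤lcp (lcp≤lengthʳ (suf S i) (suf S j))) ,
    sym (≤lcp⇒take≡ ℓ (suf S i) (suf S j) ℓ≤lcp)

  RepeatLengths : ℕ → ℕ → Set
  RepeatLengths k L = ∀ ℓ → IsRepeat S k ℓ ⇔ (1 ≤ ℓ × ℓ ≤ L)

  RepeatLengths⇒IsLBLR : (k L : ℕ) → RepeatLengths k L →
    (0 < L → IsLBLR S k L × (∀ ℓ → IsLBLR S k ℓ → ℓ ≡ L)) ×
    (L ≡ 0 → ∀ ℓ → ¬ IsLBLR S k ℓ)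
  RepeatLengths⇒IsLBLR k L lengths = longest , none
    where
    repeat⇒≤L : ∀ {ℓ} → IsRepeat S k ℓ → ℓ ≤ L
    repeat⇒≤L {ℓ} = proj₂ ∘ to (lengths ℓ)

    longest : 0 < L → IsLBLR S k L × (∀ ℓ → IsLBLR S k ℓ → ℓ ≡ L)
    longest 0<L = (repeatL , maximal) , unique
      where
      repeatL : IsRepeat S k L
      repeatL = from (lengths L) (0<L , ≤-refl)
      k+L≤n : k + L ≤ n
      k+L≤n = proj₁ (proj₂ repeatL)
      maximal : k + L ≡ n ⊎ IsUnique S k (suc L)
      maximal with k + suc L ≤? n
      ... | yes k+L<n = inj₂ (s≤s z≤n , k+L<n , λ rep → <-irrefl refl (repeat⇒≤L rep))
      ... | no k+L≮n = inj₁ (≤-antisym k+L≤n (s≤s⁻¹ (subst (n <_) (+-suc k L) (≰⇒> k+L≮n))))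
      unique : ∀ ℓ → IsLBLR S k ℓ → ℓ ≡ L
      unique ℓ (rep , maximalℓ) = ≤-antisym (repeat⇒≤L rep) (≮⇒≥ ℓ≮L)
        where
        ℓ≮L : ¬ ℓ < L
        ℓ≮L ℓ<L =
          [ (λ k+ℓ≡n → <-irrefl k+ℓ≡n (<-≤-trans (+-monoʳ-< k ℓ<L) k+L≤n))
          , (λ (_ , _ , notRepeat) → notRepeat (from (lengths (suc ℓ)) (s≤s z≤n , ℓ<L)))
          ] maximalℓ

    none : L ≡ 0 → ∀ ℓ → ¬ IsLBLR S k ℓ
    none refl ℓ (rep , _) with to (lengths ℓ) rep
    ... | 1≤ℓ , ℓ≤0 = <-irrefl refl (≤-trans 1≤ℓ ℓ≤0)

module _ {σ n : ℕ} (S : Vector (Fin σ) n) (SA : Fin n → Fin n) (isSA : IsSuffixArray S SA) where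

  lcpSA : Fin n → Fin n → ℕ
  lcpSA a b = lcp (suf S (SA a)) (suf S (SA b))

  lcpSA-comm : (a b : Fin n) → lcpSA a b ≡ lcpSA b a
  lcpSA-comm a b = lcp-comm (suf S (SA a)) (suf S (SA b))

  lcpSA-shrinkˡ : (a b c : Fin n) → a F.≤ b → b F.< c → lcpSA a c ≤ lcpSA b c
  lcpSA-shrinkˡ a b c a≤b b<c with m≤n⇒m<n∨m≡n a≤b
  ... | inj₁ a<b = proj₂ (lcp-between (isSA a b a<b) (isSA b c b<c))
  ... | inj₂ a≡b = ≤-reflexive (cong (λ x → lcpSA x c) (toℕ-injective a≡b))

  lcpSA-shrinkʳ : (a b c : Fin n) → a F.< b → b F.≤ c → lcpSA a c ≤ lcpSA a b
  lcpSA-shrinkʳ a b c a<b b≤c with m≤n⇒m<n∨m≡n b≤c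
  ... | inj₁ b<c = proj₁ (lcp-between (isSA a b a<b) (isSA b c b<c))
  ... | inj₂ b≡c = ≤-reflexive (cong (lcpSA a) (toℕ-injective (sym b≡c)))

  lcpSA-nested : (a p q c : Fin n) → a F.≤ p → p F.< q → q F.≤ c → lcpSA a c ≤ lcpSA p q
  lcpSA-nested a p q c a≤p p<q q≤c = begin
    lcpSA a c ≤⟨ lcpSA-shrinkˡ a p c a≤p (<-≤-trans p<q q≤c) ⟩
    lcpSA p c ≤⟨ lcpSA-shrinkʳ p q c p<q q≤c ⟩
    lcpSA p q ∎
    where open ≤-Reasoning

  LCP-adjacent : (m : ℕ) (p q : Fin n) → toℕ p ≡ m → toℕ q ≡ suc m →
    LCP S SA (suc (suc m)) ≡ lcpSA p q
  LCP-adjacent m p q refl q≡1+p with toℕ p <? n | suc (toℕ p) <? n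
  ... | yes p<n | yes 1+p<n =
    cong₂ lcpSA (toℕ-injective (toℕ-fromℕ< p<n)) (toℕ-injective (trans (toℕ-fromℕ< 1+p<n) (sym q≡1+p)))
  ... | no p≮n | _ = ⊥-elim (p≮n (toℕ<n p))
  ... | yes _ | no 1+p≮n = ⊥-elim (1+p≮n (subst (_< n) q≡1+p (toℕ<n q)))

  LCP-positive⇒<n : (m : ℕ) → 0 < LCP S SA (suc (suc m)) → suc m < n
  LCP-positive⇒<n m 0<LCP with m <? n | suc m <? n
  ... | yes _ | yes 1+m<n = 1+m<n
  ... | yes _ | no _ = ⊥-elim (<-irrefl refl 0<LCP)
  ... | no _ | _ = ⊥-elim (<-irrefl refl 0<LCP)

  lcpSA≤LCP : (m : ℕ) (a c : Fin n) → toℕ a ≤ m → m < toℕ c → lcpSA a c ≤ LCP S SA (suc (suc m))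
  lcpSA≤LCP m a c a≤m m<c = begin
    lcpSA a c ≤⟨ lcpSA-nested a p q c (subst (toℕ a ≤_) (sym p≡m) a≤m)
                   (≤-reflexive (trans (cong suc p≡m) (sym q≡1+m)))
                   (subst (_≤ toℕ c) (sym q≡1+m) m<c) ⟩
    lcpSA p q ≡⟨ LCP-adjacent m p q p≡m q≡1+m ⟨
    LCP S SA (suc (suc m)) ∎
    where
    open ≤-Reasoning
    1+m<n : suc m < n
    1+m<n = ≤-<-trans m<c (toℕ<n c)
    p q : Fin n
    p = fromℕ< (<-trans (n<1+n m) 1+m<n)
    q = fromℕ< 1+m<n
    p≡m : toℕ p ≡ m
    p≡m = toℕ-fromℕ< _
    q≡1+m : toℕ q ≡ suc m
    q≡1+m = toℕ-fromℕ< _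

  lcpSA≤LCP-prev : (c ρ : Fin n) → c F.< ρ → lcpSA c ρ ≤ LCP S SA (suc (toℕ ρ))
  lcpSA≤LCP-prev c ρ c<ρ with toℕ ρ in ρ≡1+m
  ... | suc m = lcpSA≤LCP m c ρ (s≤s⁻¹ c<ρ) (≤-reflexive (sym ρ≡1+m))

  LCP-prev-attained : (ρ : Fin n) → 0 < LCP S SA (suc (toℕ ρ)) →
    ∃ λ c → c ≢ ρ × LCP S SA (suc (toℕ ρ)) ≡ lcpSA ρ c
  LCP-prev-attained ρ 0<LCP with toℕ ρ in ρ≡1+m
  ... | suc m = p , p≢ρ , trans (LCP-adjacent m p ρ p≡m ρ≡1+m) (lcpSA-comm p ρ)
    where
    p : Fin n
    p = fromℕ< (<-trans (n<1+n m) (subst (_< n) ρ≡1+m (toℕ<n ρ)))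
    p≡m : toℕ p ≡ m
    p≡m = toℕ-fromℕ< _
    p≢ρ : p ≢ ρ
    p≢ρ p≡ρ = 1+n≢n (trans (sym ρ≡1+m) (trans (cong toℕ (sym p≡ρ)) p≡m))

  LCP-next-attained : (ρ : Fin n) → 0 < LCP S SA (suc (suc (toℕ ρ))) →
    ∃ λ c → c ≢ ρ × LCP S SA (suc (suc (toℕ ρ))) ≡ lcpSA ρ c
  LCP-next-attained ρ 0<LCP = q , q≢ρ , LCP-adjacent (toℕ ρ) ρ q refl q≡1+ρ
    where
    1+ρ<n : suc (toℕ ρ) < n
    1+ρ<n = LCP-positive⇒<n (toℕ ρ) 0<LCP
    q : Fin n
    q = fromℕ< 1+ρ<n
    q≡1+ρ : toℕ q ≡ suc (toℕ ρ)
    q≡1+ρ = toℕ-fromℕ< 1+ρ<n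
    q≢ρ : q ≢ ρ
    q≢ρ q≡ρ = 1+n≢n (trans (sym q≡1+ρ) (cong toℕ q≡ρ))

  neighbourLCP : Fin n → ℕ
  neighbourLCP ρ = LCP S SA (suc (toℕ ρ)) ⊔ LCP S SA (suc (suc (toℕ ρ)))

  lcpSA≤neighbourLCP : (ρ c : Fin n) → c ≢ ρ → lcpSA ρ c ≤ neighbourLCP ρ
  lcpSA≤neighbourLCP ρ c c≢ρ with Fₚ.<-cmp c ρ
  ... | tri≈ _ c≡ρ _ = ⊥-elim (c≢ρ c≡ρ)
  ... | tri< c<ρ _ _ = ≤-trans (subst (_≤ _) (lcpSA-comm c ρ) (lcpSA≤LCP-prev c ρ c<ρ)) (m≤m⊔n _ _)
  ... | tri> _ _ ρ<c = ≤-trans (lcpSA≤LCP (toℕ ρ) ρ c ≤-refl ρ<c) (m≤n⊔m _ _)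

  neighbourLCP-attained : (ρ : Fin n) → 0 < neighbourLCP ρ →
    ∃ λ c → c ≢ ρ × neighbourLCP ρ ≡ lcpSA ρ c
  neighbourLCP-attained ρ 0<L with ⊔-sel (LCP S SA (suc (toℕ ρ))) (LCP S SA (suc (suc (toℕ ρ))))
  ... | inj₁ L≡prev = Product.map₂ (Product.map₂ (trans L≡prev))
                        (LCP-prev-attained ρ (subst (0 <_) L≡prev 0<L))
  ... | inj₂ L≡next = Product.map₂ (Product.map₂ (trans L≡next))
                        (LCP-next-attained ρ (subst (0 <_) L≡next 0<L))

module _ {σ n : ℕ} (S : Vector (Fin σ) n) (SA Rank : Fin n → Fin n)
  (isSA : IsSuffixArray S SA) (isRank : IsRankArray S SA Rank) where

  private
    SA∘Rank : ∀ i → SA (Rank i) ≡ i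
    SA∘Rank = proj₁ isRank

    Rank∘SA : ∀ c → Rank (SA c) ≡ c
    Rank∘SA = proj₂ isRank

  lcp-suf≤Lval : (i j : Fin n) → j ≢ i → lcp (suf S i) (suf S j) ≤ Lval S SA Rank i
  lcp-suf≤Lval i j j≢i =
    subst₂ (λ x y → lcp (suf S x) (suf S y) ≤ Lval S SA Rank i) (SA∘Rank i) (SA∘Rank j)
      (lcpSA≤neighbourLCP S SA isSA (Rank i) (Rank j) (j≢i ∘ Rank-injective))
    where
    Rank-injective : Rank j ≡ Rank i → j ≡ i
    Rank-injective eq = trans (sym (SA∘Rank j)) (trans (cong SA eq) (SA∘Rank i))

  Lval-attained : (i : Fin n) → 0 < Lval S SA Rank i →
    ∃ λ j → j ≢ i × Lval S SA Rank i ≡ lcp (suf S i) (suf S j)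
  Lval-attained i 0<L with neighbourLCP-attained S SA isSA (Rank i) 0<L
  ... | c , c≢Rank-i , L≡lcpSA =
    SA c , (λ SAc≡i → c≢Rank-i (trans (sym (Rank∘SA c)) (cong Rank SAc≡i))) ,
    trans L≡lcpSA (cong (λ x → lcp (suf S x) (suf S (SA c))) (SA∘Rank i))

  repeatLengths-Lval : (i : Fin n) → RepeatLengths S (toℕ i) (Lval S SA Rank i)
  repeatLengths-Lval i ℓ = mk⇔ bounded repeat
    where
    bounded : IsRepeat S (toℕ i) ℓ → 1 ≤ ℓ × ℓ ≤ Lval S SA Rank i
    bounded rep with repeat⇒≤lcp S i ℓ rep
    ... | j , j≢i , ℓ≤lcp = proj₁ rep , ≤-trans ℓ≤lcp (lcp-suf≤Lval i j j≢i)

    repeat : 1 ≤ ℓ × ℓ ≤ Lval S SA Rank i → IsRepeat S (toℕ i) ℓ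
    repeat (1≤ℓ , ℓ≤L) with Lval-attained i (≤-trans 1≤ℓ ℓ≤L)
    ... | j , j≢i , L≡lcp = ≤lcp⇒repeat S i j ℓ j≢i 1≤ℓ (subst (ℓ ≤_) L≡lcp ℓ≤L)

lemma1 : ∀ {σ n : ℕ} (S : Vector (Fin σ) n) (SA Rank : Fin n → Fin n) →
    IsSuffixArray S SA → IsRankArray S SA Rank → (i : Fin n) →
    (0 < Lval S SA Rank i →
      IsLBLR S (toℕ i) (Lval S SA Rank i) ×
      (∀ ℓ → IsLBLR S (toℕ i) ℓ → ℓ ≡ Lval S SA Rank i)) ×
    (Lval S SA Rank i ≡ 0 → ∀ ℓ → ¬ IsLBLR S (toℕ i) ℓ)
lemma1 S SA Rank isSA isRank i =
  RepeatLengths⇒IsLBLR S (toℕ i) (Lval S SA Rank i) (repeatLengths-Lval S SA Rank isSA isRank i)
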